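{- Let $n$ be a positive integer. Then $$p^{(3)}(n)\le p^{(2)}(n-1).$$
   Context: A partition of a positive integer $n$ is a finite sequence $\lambda=[\lambda_1,\ldots,\lambda_k]$ of positive integers with $\lambda_1\ge\cdots\ge\lambda_k$ summing to $n$. For positive integers $n,t$, $p^{(t)}(n)$ denotes the number of partitions $\lambda$ of $n$ with $\lambda_1\ge t\cdot\lambda_2$, where the one-part partition $[n]$ is considered to satisfy this condition. Convention: $p^{(2)}(0)=1$ (the empty partition of $0$ is counted). -}

module Defs where

open import Data.Nat using (ℕ; zero; suc; _+_; _*_; _≤ᵇ_; _≡ᵇ_)
open import Data.Bool using (Bool; true; false; _∧_; T)
open import Data.List using (List; []; _∷_; map; concatMap; filterᵇ; length; upTo)
open import Data.Nat.ListAction using (sum)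

nonIncreasing : List ℕ → Bool
nonIncreasing []           = true
nonIncreasing (x ∷ [])     = true
nonIncreasing (x ∷ y ∷ xs) = (y ≤ᵇ x) ∧ nonIncreasing (y ∷ xs)

allPositive : List ℕ → Bool
allPositive []       = true
allPositive (x ∷ xs) = (1 ≤ᵇ x) ∧ allPositive xs

isPartition : ℕ → List ℕ → Bool
isPartition n l = nonIncreasing l ∧ allPositive l ∧ (sum l ≡ᵇ n)

-- the condition λ₁ ≥ t·λ₂ ; vacuously true for partitions with fewer than
-- two parts (the one-part partition [n], and the empty partition of 0)
tCondition : ℕ → List ℕ → Bool
tCondition t (x ∷ y ∷ _) = (t * y) ≤ᵇ x
tCondition t _           = true

listsOfLength : ℕ → List ℕ → List (List ℕ)
listsOfLength zero    A = [] ∷ []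
listsOfLength (suc m) A = concatMap (λ a → map (a ∷_) (listsOfLength m A)) A

-- candidate lists: every list of length ≤ n with entries in {1,…,n}.
-- Each list occurs exactly once, and every partition of n is among them.
candidates : ℕ → List (List ℕ)
candidates n = concatMap (λ m → listsOfLength m (map suc (upTo n))) (upTo (suc n))

p : ℕ → ℕ → ℕ
p t n = length (filterᵇ (λ l → isPartition n l ∧ tCondition t l) (candidates n))

module Submission where

-- Map a partition λ of n+1 with λ₁ ≥ 3λ₂ to the list  shrink λ  obtained by
-- lowering its largest part by one (dropping it if it becomes 0).  For two or
-- more parts, λ₂ ≥ 1 gives  λ₁ - 1 ≥ 3λ₂ - 1 ≥ 2λ₂ ≥ λ₂, so  shrink λ  is a
-- partition of n with λ₁ ≥ 2λ₂; the one-part partition [n+1] goes to [n]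
-- (or to the empty partition when n = 0).  On partitions of n+1, shrink is
-- injective: it keeps the number of parts ≥ 2 apart from the one-part case
-- and it only changes the (positive) largest part.

open import Defs
open import Data.Nat using (ℕ; zero; suc; pred; _+_; _*_; _≤_; _≤ᵇ_; z≤n; s≤s)
open import Data.Nat.Properties
open import Data.Nat.ListAction using (sum)
open import Data.Bool using (Bool; _∧_; T; T?)
open import Data.Bool.Properties using (T-∧)
open import Data.Empty using (⊥-elim)
open import Data.Product using (_×_; _,_; proj₁; proj₂)
open import Data.List using (List; []; _∷_; map; concatMap; filterᵇ; length; upTo)
open import Data.List.Properties using (length-map; ∷-injectiveʳ; ∷-injectiveˡ)
open import Data.List.Relation.Unary.All as All using (All; []; _∷_)
import Data.List.Relation.Unary.All.Properties as All
open import Data.List.Relation.Unary.Any as Any using (here; there)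
open import Data.List.Relation.Unary.AllPairs using ([]; _∷_)
open import Data.List.Relation.Unary.Unique.Propositional using (Unique)
import Data.List.Relation.Unary.Unique.Propositional.Properties as Unique
open import Data.List.Relation.Binary.Subset.Propositional using (_⊆_)
open import Data.List.Relation.Binary.Disjoint.Propositional using (Disjoint)
open import Data.List.Membership.Propositional using (_∈_; find)
open import Data.List.Membership.Propositional.Properties
open import Function.Base using (_∘_)
open import Function.Bundles using (Equivalence)
open import Relation.Binary.PropositionalEquality

module _ {A : Set} where

  remove : ∀ {x} (ys : List A) → x ∈ ys → List A
  remove (y ∷ ys) (here _)   = ys
  remove (y ∷ ys) (there x∈) = y ∷ remove ys x∈

  remove-length : ∀ {x} (ys : List A) (x∈ : x ∈ ys) → suc (length (remove ys x∈)) ≡ length ys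
  remove-length (y ∷ ys) (here _)   = refl
  remove-length (y ∷ ys) (there x∈) = cong suc (remove-length ys x∈)

  ∈-remove : ∀ {x z} (ys : List A) (x∈ : x ∈ ys) → z ∈ ys → z ≢ x → z ∈ remove ys x∈
  ∈-remove (y ∷ ys) (here refl) (here refl) z≢x = ⊥-elim (z≢x refl)
  ∈-remove (y ∷ ys) (here refl) (there z∈)  _   = z∈
  ∈-remove (y ∷ ys) (there x∈)  (here refl) _   = here refl
  ∈-remove (y ∷ ys) (there x∈)  (there z∈)  z≢x = there (∈-remove ys x∈ z∈ z≢x)

  unique-⊆⇒length-≤ : (xs ys : List A) → Unique xs → xs ⊆ ys → length xs ≤ length ys
  unique-⊆⇒length-≤ []       ys _              _  = z≤n
  unique-⊆⇒length-≤ (x ∷ xs) ys (x∉xs ∷ uniq) xs⊆ys =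
    subst (suc (length xs) ≤_) (remove-length ys x∈ys)
      (s≤s (unique-⊆⇒length-≤ xs (remove ys x∈ys) uniq xs⊆rest))
    where
    x∈ys : x ∈ ys
    x∈ys = xs⊆ys (here refl)
    xs⊆rest : xs ⊆ remove ys x∈ys
    xs⊆rest z∈xs = ∈-remove ys x∈ys (xs⊆ys (there z∈xs)) (λ z≡x → All.lookup x∉xs z∈xs (sym z≡x))

InjectiveOn : {A B : Set} → (A → B) → List A → Set
InjectiveOn f xs = ∀ {a b} → a ∈ xs → b ∈ xs → f a ≡ f b → a ≡ b

module _ {A B : Set} where

  map-unique : (f : A → B) (xs : List A) → Unique xs → InjectiveOn f xs → Unique (map f xs)
  map-unique f []       _             _   = []
  map-unique f (x ∷ xs) (x∉xs ∷ uniq) inj =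
    All.map⁺ (All.tabulate (λ z∈xs fx≡fz → All.lookup x∉xs z∈xs (inj (here refl) (there z∈xs) fx≡fz)))
    ∷ map-unique f xs uniq (λ a∈ b∈ → inj (there a∈) (there b∈))

  injection⇒length-≤ : (f : A → B) (xs : List A) (ys : List B) →
                       Unique xs → InjectiveOn f xs → (∀ {a} → a ∈ xs → f a ∈ ys) →
                       length xs ≤ length ys
  injection⇒length-≤ f xs ys uniq inj into =
    subst (_≤ length ys) (length-map f xs)
      (unique-⊆⇒length-≤ (map f xs) ys (map-unique f xs uniq inj) image⊆ys)
    where
    image⊆ys : map f xs ⊆ ys
    image⊆ys fa∈ with ∈-map⁻ f fa∈
    ... | a , a∈xs , refl = into a∈xs

  concatMap-unique : (f : A → List B) (xs : List A) → Unique xs → (∀ a → Unique (f a)) →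
                     (∀ {a b y} → y ∈ f a → y ∈ f b → a ≡ b) → Unique (concatMap f xs)
  concatMap-unique f []       _             _     _        = []
  concatMap-unique f (x ∷ xs) (x∉xs ∷ uniq) uniqF disjoint =
    Unique.++⁺ (uniqF x) (concatMap-unique f xs uniq uniqF disjoint) fx-disjoint
    where
    fx-disjoint : Disjoint (f x) (concatMap f xs)
    fx-disjoint (y∈fx , y∈rest) with find (∈-concatMap⁻ f {xs = xs} y∈rest)
    ... | z , z∈xs , y∈fz = All.lookup x∉xs z∈xs (disjoint y∈fx y∈fz)

-- The enumeration behind p: listsOfLength m A lists each word of length m
-- over A once, so candidates n has no repetitions and contains every
-- partition of n (whose parts lie in {1,…,n} and number at most n).

-- every listed word has the prescribed length (so different m give disjoint blocks)
listsOfLength-length : ∀ m A {l} → l ∈ listsOfLength m A → length l ≡ m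
listsOfLength-length zero    A (here refl) = refl
listsOfLength-length (suc m) A l∈
  with find (∈-concatMap⁻ (λ a → map (a ∷_) (listsOfLength m A)) {xs = A} l∈)
... | a , _ , l∈a∷ with ∈-map⁻ (a ∷_) l∈a∷
... | l , l∈ , refl = cong suc (listsOfLength-length m A l∈)

listsOfLength-unique : ∀ m A → Unique A → Unique (listsOfLength m A)
listsOfLength-unique zero    A _     = [] ∷ []
listsOfLength-unique (suc m) A uniqA =
  concatMap-unique (λ a → map (a ∷_) (listsOfLength m A)) A uniqA
    (λ a → Unique.map⁺ ∷-injectiveʳ (listsOfLength-unique m A uniqA)) same-head
  where
  same-head : ∀ {a b l} → l ∈ map (a ∷_) (listsOfLength m A) → l ∈ map (b ∷_) (listsOfLength m A) → a ≡ b
  same-head l∈a l∈b with ∈-map⁻ _ l∈a | ∈-map⁻ _ l∈b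
  ... | _ , _ , refl | _ , _ , eq = ∷-injectiveˡ eq

listsOfLength-complete : ∀ {A} (l : List ℕ) → All (_∈ A) l → l ∈ listsOfLength (length l) A
listsOfLength-complete     []      []          = here refl
listsOfLength-complete {A} (x ∷ l) (x∈A ∷ l⊆A) =
  ∈-concatMap⁺ (λ a → map (a ∷_) (listsOfLength (length l) A))
    (Any.map (λ { refl → ∈-map⁺ (x ∷_) (listsOfLength-complete l l⊆A) }) x∈A)

candidates-unique : ∀ n → Unique (candidates n)
candidates-unique n =
  concatMap-unique (λ m → listsOfLength m (map suc (upTo n))) (upTo (suc n)) (Unique.upTo⁺ (suc n))
    (λ m → listsOfLength-unique m _ (Unique.map⁺ suc-injective (Unique.upTo⁺ n)))
    (λ l∈m l∈m′ → trans (sym (listsOfLength-length _ _ l∈m)) (listsOfLength-length _ _ l∈m′))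

unpack : ∀ {a b} → T (a ∧ b) → T a × T b
unpack = Equivalence.to T-∧

pack : ∀ {a b} → T a → T b → T (a ∧ b)
pack ta tb = Equivalence.from T-∧ (ta , tb)

allPositive⇒All : ∀ l → T (allPositive l) → All (1 ≤_) l
allPositive⇒All []      _ = []
allPositive⇒All (x ∷ l) t with unpack {1 ≤ᵇ x} t
... | 1≤x , rest = ≤ᵇ⇒≤ 1 x 1≤x ∷ allPositive⇒All l rest

partition-parts : ∀ {m} l → T (isPartition m l) → All (1 ≤_) l × sum l ≡ m
partition-parts {m} l t with unpack {nonIncreasing l} t
... | _ , rest with unpack {allPositive l} rest
... | positive , sum≡ = allPositive⇒All l positive , ≡ᵇ⇒≡ (sum l) m sum≡

length≤sum : ∀ {l} → All (1 ≤_) l → length l ≤ sum l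
length≤sum []               = z≤n
length≤sum (1≤x ∷ positive) = +-mono-≤ 1≤x (length≤sum positive)

part≤sum : ∀ l → All (_≤ sum l) l
part≤sum []      = []
part≤sum (x ∷ l) = m≤m+n x (sum l) ∷ All.map (λ y≤ → ≤-trans y≤ (m≤n+m (sum l) x)) (part≤sum l)

candidates-complete : ∀ n l → T (isPartition n l) → l ∈ candidates n
candidates-complete n l t =
  ∈-concatMap⁺ (λ m → listsOfLength m (map suc (upTo n))) {xs = upTo (suc n)}
    (Any.map (λ { refl → listsOfLength-complete l (All.zipWith in-range (positive , bounded)) })
      (∈-upTo⁺ (s≤s (subst (length l ≤_) sum≡n (length≤sum positive)))))
  where
  positive : All (1 ≤_) l
  positive = proj₁ (partition-parts l t)
  sum≡n : sum l ≡ n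
  sum≡n = proj₂ (partition-parts l t)
  bounded : All (_≤ n) l
  bounded = subst (λ s → All (_≤ s) l) sum≡n (part≤sum l)
  in-range : ∀ {x} → 1 ≤ x × x ≤ n → x ∈ map suc (upTo n)
  in-range (s≤s _ , x≤n) = ∈-map⁺ suc (∈-upTo⁺ x≤n)

counted : ℕ → ℕ → List ℕ → Bool
counted t m l = isPartition m l ∧ tCondition t l

shrink : List ℕ → List ℕ
shrink (x ∷ y ∷ r)        = pred x ∷ y ∷ r
shrink (suc (suc k) ∷ []) = suc k ∷ []
shrink _                  = []

singleton-value : ∀ {m x} → T (isPartition m (x ∷ [])) → x ≡ m
singleton-value {m} {x} t = trans (sym (+-identityʳ x)) (proj₂ (partition-parts (x ∷ []) t))

shrink-singleton : ∀ m → T (counted 2 m (shrink (suc m ∷ [])))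
shrink-singleton zero    = _
shrink-singleton (suc k) = pack (≡⇒≡ᵇ (k + 0) k (+-identityʳ k)) _

lower-head : ∀ {m x y r} → T (isPartition (suc m) (suc x ∷ y ∷ r)) → y ≤ x → T (isPartition m (x ∷ y ∷ r))
lower-head {m} {x} {y} {r} t y≤x with unpack {(y ≤ᵇ suc x) ∧ nonIncreasing (y ∷ r)} t
... | ordered , positive∧sum with unpack {y ≤ᵇ suc x} ordered | unpack {allPositive (y ∷ r)} positive∧sum
... | _ , tail-ordered | positive , sum≡ =
  pack (pack (≤⇒≤ᵇ y≤x) tail-ordered) (pack (pack (≤⇒≤ᵇ 1≤x) positive) sum≡)
  where
  1≤x : 1 ≤ x
  1≤x = ≤-trans (All.head (allPositive⇒All (y ∷ r) positive)) y≤x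

three-to-two : ∀ {x y} → 1 ≤ y → 3 * y ≤ suc x → 2 * y ≤ x
three-to-two {x} {suc y} _ (s≤s 3y≤) = ≤-trans (m≤n+m (2 * suc y) y) 3y≤

-- shrink sends partitions of n+1 with λ₁ ≥ 3λ₂ to partitions of n with λ₁ ≥ 2λ₂.
-- (The empty list is not a partition of n+1, so that case is absurd and
-- omitted; a zero largest part contradicts positivity.)
shrink-counted : ∀ n l → T (counted 3 (suc n) l) → T (counted 2 n (shrink l))
shrink-counted n (x ∷ []) t with singleton-value {suc n} {x} (proj₁ (unpack t))
... | refl = shrink-singleton n
shrink-counted n (zero ∷ y ∷ r) t with partition-parts {suc n} (zero ∷ y ∷ r) (proj₁ (unpack {isPartition (suc n) (zero ∷ y ∷ r)} {tCondition 3 (zero ∷ y ∷ r)} t))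
... | () ∷ _ , _
shrink-counted n (suc x ∷ y ∷ r) t with unpack {isPartition (suc n) (suc x ∷ y ∷ r)} {3 * y ≤ᵇ suc x} t
... | isP , condition with partition-parts {suc n} (suc x ∷ y ∷ r) isP
... | _ ∷ 1≤y ∷ _ , _ = pack (lower-head {n} {x} {y} {r} isP (≤-trans (m≤m+n y (y + 0)) 2y≤)) (≤⇒≤ᵇ 2y≤)
  where
  2y≤ : 2 * y ≤ x
  2y≤ = three-to-two 1≤y (≤ᵇ⇒≤ (3 * y) (suc x) condition)

shrink-singleton-short : ∀ x {a b r} → shrink (x ∷ []) ≢ a ∷ b ∷ r
shrink-singleton-short zero          ()
shrink-singleton-short (suc zero)    ()
shrink-singleton-short (suc (suc k)) ()

-- on partitions of a positive integer, shrink is injective (the empty list is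
-- not such a partition, so those cases are absurd and omitted)
shrink-injective : ∀ {n} l l′ → T (isPartition (suc n) l) → T (isPartition (suc n) l′) → shrink l ≡ shrink l′ → l ≡ l′
shrink-injective (x ∷ [])    (x′ ∷ [])      t t′ _ = cong (_∷ []) (trans (singleton-value t) (sym (singleton-value t′)))
shrink-injective (x ∷ [])    (_ ∷ _ ∷ _)    _ _  e = ⊥-elim (shrink-singleton-short x e)
shrink-injective (_ ∷ _ ∷ _) (x′ ∷ [])      _ _  e = ⊥-elim (shrink-singleton-short x′ (sym e))
shrink-injective (x ∷ y ∷ r) (x′ ∷ y′ ∷ r′) t t′ e =
  unshrink (All.head (proj₁ (partition-parts (x ∷ y ∷ r) t)))
           (All.head (proj₁ (partition-parts (x′ ∷ y′ ∷ r′) t′))) e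
  where
  unshrink : ∀ {a a′} {s s′ : List ℕ} → 1 ≤ a → 1 ≤ a′ → pred a ∷ s ≡ pred a′ ∷ s′ → a ∷ s ≡ a′ ∷ s′
  unshrink (s≤s _) (s≤s _) refl = refl

corollary4 : (n : ℕ) → p 3 (suc n) ≤ p 2 n
corollary4 n =
  injection⇒length-≤ shrink source target
    (Unique.filter⁺ (T? ∘ counted 3 (suc n)) (candidates-unique (suc n))) injective into
  where
  source target : List (List ℕ)
  source = filterᵇ (counted 3 (suc n)) (candidates (suc n))
  target = filterᵇ (counted 2 n) (candidates n)

  source-counted : ∀ {l} → l ∈ source → T (counted 3 (suc n) l)
  source-counted l∈ = proj₂ (∈-filter⁻ (T? ∘ counted 3 (suc n)) {xs = candidates (suc n)} l∈)

  injective : InjectiveOn shrink source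
  injective {l} {l′} l∈ l′∈ =
    shrink-injective l l′ (proj₁ (unpack (source-counted l∈))) (proj₁ (unpack (source-counted l′∈)))

  into : ∀ {l} → l ∈ source → shrink l ∈ target
  into {l} l∈ = ∈-filter⁺ (T? ∘ counted 2 n) (candidates-complete n (shrink l) (proj₁ (unpack image))) image
    where
    image : T (counted 2 n (shrink l))
    image = shrink-counted n l (source-counted l∈)
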